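{- Let $d$ and $t_n$ be integers with $t_n\ge d+3$, and let $G_n$ be a $d$-regular, $d$-connected graph on $t_n$ vertices with $\kappa_3(G_n)=d-1$. Let $H_n=G_n^1\oplus G_n^2\oplus\cdots\oplus G_n^{t_n}$ be as described in the context. For any cluster $G_n^i$ ($1\le i\le t_n$), let $H=H_n\setminus V(G_n^i)$. Then $\kappa(H)=d$.
   Context: All graphs are simple. $\kappa(G)$ denotes the (vertex) connectivity of $G$. For $S\subseteq V(G)$, an $S$-tree is a tree $T$ in $G$ with $S\subseteq V(T)$; trees $T_1,\dots,T_r$ are internally edge disjoint $S$-trees if $V(T_i)\cap V(T_j)=S$ and $E(T_i)\cap E(T_j)=\emptyset$ for all $i\ne j$. $\kappa_G(S)$ is the maximum number of internally edge disjoint $S$-trees in $G$, and for $2\le k\le |V(G)|$, the generalized $k$-connectivity is $\kappa_k(G)=\min\{\kappa_G(S): S\subseteq V(G),|S|=k\}$. Construction of $H_n$: take $t_n$ disjoint copies $G_n^1,\dots,G_n^{t_n}$ of $G_n$ (called clusters) and add $\frac12 t_n^2$ edges so that the resulting graph $H_n$ is $(d+1)$-regular and (1) every vertex $x$ of a cluster $G_n^i$ has exactly one neighbour outside $G_n^i$ (its out-neighbour $\hat x$); (2) for all $1\le i\ne j\le t_n$ there are one or two edges between $G_n^i$ and $G_n^j$. $G\setminus V'$ denotes deleting the vertex set $V'$ and all incident edges. -}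

module Defs where

open import Data.Nat using (ℕ; zero; suc; _+_; _*_; _<_; _≤_)
open import Data.Bool using (Bool; true; false; not)
open import Data.Fin using (Fin; zero; suc; inject₁; fromℕ; combine; quotient; _≟_)
open import Data.Fin.Subset using (Subset; _∈_; _∉_; _⊆_; ∣_∣; _∩_; ∁)
open import Data.Vec using (tabulate; sum)
open import Data.Product using (Σ; ∃; ∃-syntax; _×_; _,_)
open import Data.Sum using (_⊎_)
open import Data.Empty using (⊥)
open import Relation.Nullary using (¬_; does)
open import Relation.Binary.PropositionalEquality using (_≡_; _≢_)
open import Function.Definitions using (Injective)

record SimpleGraph (n : ℕ) : Set where
  field
    adj    : Fin n → Fin n → Bool
    sym    : ∀ u v → adj u v ≡ adj v u
    irrefl : ∀ v → adj v v ≡ false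
open SimpleGraph public

nbhd : ∀ {n} → SimpleGraph n → Fin n → Subset n
nbhd G v = tabulate (adj G v)

Regular : ∀ {n} → SimpleGraph n → ℕ → Set
Regular G d = ∀ v → ∣ nbhd G v ∣ ≡ d

data Walk {n : ℕ} (R : Fin n → Fin n → Bool) (A : Subset n) : Fin n → Fin n → Set where
  here : ∀ {u} → u ∈ A → Walk R A u u
  step : ∀ {u w v} → u ∈ A → R u w ≡ true → Walk R A w v → Walk R A u v

Connected : ∀ {n} → SimpleGraph n → Subset n → Set
Connected G A = ∀ u v → u ∈ A → v ∈ A → Walk (adj G) A u v

_∖_ : ∀ {n} → Subset n → Subset n → Subset n
A ∖ X = A ∩ ∁ X

KConnected : ∀ {n} → SimpleGraph n → Subset n → ℕ → Set
KConnected {n} G A k =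
  k < ∣ A ∣ × (∀ (X : Subset n) → X ⊆ A → ∣ X ∣ < k → Connected G (A ∖ X))

IsConnectivity : ∀ {n} → SimpleGraph n → Subset n → ℕ → Set
IsConnectivity G A k = KConnected G A k × (∀ m → KConnected G A m → m ≤ k)

record SubGraph (n : ℕ) : Set where
  field
    V : Subset n
    E : Fin n → Fin n → Bool
open SubGraph public

Cycle : ∀ {n} → (Fin n → Fin n → Bool) → Set
Cycle {n} R =
  Σ ℕ λ k → Σ (Fin (suc (suc (suc k))) → Fin n) λ f →
    Injective _≡_ _≡_ f
    × (∀ (i : Fin (suc (suc k))) → R (f (inject₁ i)) (f (suc i)) ≡ true)
    × R (f (fromℕ (suc (suc k)))) (f zero) ≡ true

IsTree : ∀ {n} → SimpleGraph n → SubGraph n → Set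
IsTree G T =
    (∀ u v → E T u v ≡ true → adj G u v ≡ true)
  × (∀ u v → E T u v ≡ E T v u)
  × (∀ u v → E T u v ≡ true → u ∈ V T × v ∈ V T)
  × (∀ u v → u ∈ V T → v ∈ V T → Walk (E T) (V T) u v)
  × ¬ Cycle (E T)

IsSTree : ∀ {n} → SimpleGraph n → Subset n → SubGraph n → Set
IsSTree G S T = IsTree G T × S ⊆ V T

DisjointSTrees : ∀ {n} → SimpleGraph n → Subset n → (r : ℕ) → (Fin r → SubGraph n) → Set
DisjointSTrees {n} G S r T =
    (∀ i → IsSTree G S (T i))
  × (∀ i j → i ≢ j →
       (∀ (v : Fin n) → v ∈ V (T i) → v ∈ V (T j) → v ∈ S)
     × (∀ u v → E (T i) u v ≡ true → E (T j) u v ≡ true → ⊥))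

HasDisjointSTrees : ∀ {n} → SimpleGraph n → Subset n → ℕ → Set
HasDisjointSTrees {n} G S r = Σ (Fin r → SubGraph n) (DisjointSTrees G S r)

IsKappaS : ∀ {n} → SimpleGraph n → Subset n → ℕ → Set
IsKappaS G S r = HasDisjointSTrees G S r × (∀ m → HasDisjointSTrees G S m → m ≤ r)

IsKappa3 : ∀ {n} → SimpleGraph n → ℕ → Set
IsKappa3 {n} G k =
    (∀ (S : Subset n) → ∣ S ∣ ≡ 3 → ∀ r → IsKappaS G S r → k ≤ r)
  × (∃[ S ] (∣ S ∣ ≡ 3 × IsKappaS G S k))

-- The construction H_n.  Vertex x of cluster G^i is  combine i x : Fin (t * t).

crossEdges : ∀ {t} → SimpleGraph (t * t) → Fin t → Fin t → ℕ
crossEdges H i j = sum (tabulate λ x → ∣ tabulate (λ y → adj H (combine i x) (combine j y)) ∣)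

IsConstruction : ∀ {t} → ℕ → SimpleGraph t → SimpleGraph (t * t) → Set
IsConstruction {t} d G H =
    (∀ (i : Fin t) x y → adj H (combine i x) (combine i y) ≡ adj G x y)
  × Regular H (suc d)
  × (∀ (i : Fin t) x → ∃[ j ] ∃[ y ] (i ≢ j × adj H (combine i x) (combine j y) ≡ true
        × (∀ j' y' → i ≢ j' → adj H (combine i x) (combine j' y') ≡ true → j' ≡ j × y' ≡ y)))
  × (∀ (i j : Fin t) → i ≢ j → crossEdges H i j ≡ 1 ⊎ crossEdges H i j ≡ 2)

outsideCluster : ∀ t → Fin t → Subset (t * t)
outsideCluster t i = tabulate λ v → not (does (quotient t v ≟ i))

-- Deleting a set X of fewer than d vertices from H − G^i leaves it connected. Within a cluster
-- this is the d-connectivity of G. Vertices of clusters j and k (possibly j = k) are joined by a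
-- detour j → l → k through any cluster l ∉ {i, j, k}, using one cross edge j–l and one cross edge
-- l–k; a vertex of X can block the detour through l only if it lies in l or is a vertex of j or k
-- whose out-neighbour lies in l, so blocking all t − 3 ≥ d detours would need d distinct vertices
-- of X. Conversely, the out-neighbour of a vertex of G^i has at most d neighbours in H − G^i, and
-- deleting them separates it from a vertex of a third cluster.

module Submission where

open import Defs hiding (sym)
open import Data.Bool using (Bool; true; false; not)
open import Data.Bool.Properties using (¬-not)
open import Data.Fin using (Fin; zero; suc; combine; quotient; remainder; _≟_)
open import Data.Fin.Properties
  using (combine-injectiveˡ; combine-injectiveʳ; combine-remQuot; remQuot-combine; suc-injective; 0≢1+n)
open import Data.Fin.Subset
  using (Subset; _∈_; _∉_; _⊆_; ∣_∣; _∩_; ∁; ⁅_⁆; _─_; _-_; Nonempty; inside; outside; ⊤)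
open import Data.Fin.Subset.Properties
  using ( x∈p∩q⁺; x∈p∩q⁻; p∩q⊆q; x∉p⇒x∈∁p; x∈∁p⇒x∉p; p─q⊆p; drop-there; p⊆q⇒∣p∣≤∣q∣; x∈⁅x⁆; _∈?_
        ; ∣⊤∣≡n; ∈⊤; ⊆⊤; x∈p∧x≢y⇒x∈p-y; x∈p⇒∣p-x∣<∣p∣; nonempty?; Empty-unique; ∣⊥∣≡0)
open import Data.Nat using (ℕ; zero; suc; _+_; _*_; _≤_; _<_; z≤n; s≤s; s≤s⁻¹)
open import Data.Nat.Properties
  using ( ≤-trans; ≤-<-trans; <-≤-trans; ≮⇒≥; ≤⇒≯; <⇒≢; n≤1+n; m+n≤o⇒n≤o; +-cancelˡ-≤; +-comm
        ; module ≤-Reasoning)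
open import Data.Product using (∃; _×_; _,_; proj₁; proj₂)
open import Data.Sum using (_⊎_; inj₁; inj₂; map₂)
open import Data.Vec using (tail; _∷_; []; lookup; tabulate; sum; here; there)
open import Data.Vec.Properties using (lookup∘tabulate; lookup⇒[]=; []=⇒lookup)
open import Function using (_∘_; const)
open import Function.Definitions using (Injective)
open import Relation.Nullary using (¬_; yes; no; does; contradiction)
open import Relation.Nullary.Decidable using (dec-true; dec-false)
open import Relation.Binary.PropositionalEquality
  using (_≡_; _≢_; refl; sym; trans; cong; subst; module ≡-Reasoning)

∈-tabulate⁺ : ∀ {n} {f : Fin n → Bool} {x} → f x ≡ true → x ∈ tabulate f
∈-tabulate⁺ {f = f} {x} fx = lookup⇒[]= x _ (trans (lookup∘tabulate f x) fx)

∈-tabulate⁻ : ∀ {n} {f : Fin n → Bool} {x} → x ∈ tabulate f → f x ≡ true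
∈-tabulate⁻ {f = f} {x} x∈ = trans (sym (lookup∘tabulate f x)) ([]=⇒lookup x∈)

x∈p─q⇒x∉q : ∀ {n} {p q : Subset n} {x} → x ∈ p ─ q → x ∉ q
x∈p─q⇒x∉q {p = inside ∷ p} {outside ∷ q} here ()
x∈p─q⇒x∉q {p = _ ∷ p} {_ ∷ q} (there x∈) (there x∈q) = x∈p─q⇒x∉q x∈ x∈q

x∈p-y⁻ : ∀ {n} {p : Subset n} {x y} → x ∈ p - y → x ∈ p × x ≢ y
x∈p-y⁻ {p = p} {y = y} x∈ = p─q⊆p p ⁅ y ⁆ x∈ , λ { refl → x∈p─q⇒x∉q x∈ (x∈⁅x⁆ y) }

-- (s ∷ p) - x does not reduce to a cons of p - x', since _─_ zips with an operator bound locally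
-- to its arguments; the tail of (s ∷ p) - x is therefore only compared with p - x' through ⊆.
∣p∣≤1+∣p-x∣ : ∀ {n} (p : Subset n) x → ∣ p ∣ ≤ suc ∣ p - x ∣
∣p∣≤1+∣p-x∣ (s ∷ p) zero = shift s
  where
  p⊆tail : p ⊆ tail ((s ∷ p) - zero)
  p⊆tail y∈p = drop-there (x∈p∧x≢y⇒x∈p-y {p = s ∷ p} {y = zero} (there y∈p) λ ())
  shift : ∀ b → ∣ b ∷ p ∣ ≤ suc ∣ outside ∷ tail ((s ∷ p) - zero) ∣
  shift outside = ≤-trans (p⊆q⇒∣p∣≤∣q∣ p⊆tail) (n≤1+n _)
  shift inside  = s≤s (p⊆q⇒∣p∣≤∣q∣ p⊆tail)
∣p∣≤1+∣p-x∣ (s ∷ p) (suc x) = shift s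
  where
  p-x⊆tail : p - x ⊆ tail ((s ∷ p) - suc x)
  p-x⊆tail y∈p-x = let y∈p , y≢x = x∈p-y⁻ y∈p-x in
    drop-there (x∈p∧x≢y⇒x∈p-y {p = s ∷ p} {y = suc x} (there y∈p) λ e → y≢x (suc-injective e))
  ∣p∣≤1+∣tail∣ : ∣ p ∣ ≤ suc ∣ tail ((s ∷ p) - suc x) ∣
  ∣p∣≤1+∣tail∣ = ≤-trans (∣p∣≤1+∣p-x∣ p x) (s≤s (p⊆q⇒∣p∣≤∣q∣ p-x⊆tail))
  shift : ∀ b → ∣ b ∷ p ∣ ≤ suc ∣ b ∷ tail ((s ∷ p) - suc x) ∣
  shift outside = ∣p∣≤1+∣tail∣
  shift inside  = s≤s ∣p∣≤1+∣tail∣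

0<∣p∣⇒Nonempty : ∀ {n} (p : Subset n) → 0 < ∣ p ∣ → Nonempty p
0<∣p∣⇒Nonempty {n} p 0<∣p∣ with nonempty? p
... | yes ne = ne
... | no ¬ne = contradiction (trans (cong ∣_∣ (Empty-unique ¬ne)) (∣⊥∣≡0 n)) (<⇒≢ 0<∣p∣ ∘ sym)

∣p∣≤∣q∣-injection : ∀ {m n} {p : Subset m} {q : Subset n} (f : ∀ {x} → x ∈ p → Fin n)
                  → (∀ {x} (x∈p : x ∈ p) → f x∈p ∈ q)
                  → (∀ {x y} (x∈p : x ∈ p) (y∈p : y ∈ p) → f x∈p ≡ f y∈p → x ≡ y)
                  → ∣ p ∣ ≤ ∣ q ∣
∣p∣≤∣q∣-injection {p = []} f f∈q f-inj = z≤n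
∣p∣≤∣q∣-injection {p = outside ∷ p} f f∈q f-inj =
  ∣p∣≤∣q∣-injection (f ∘ there) (f∈q ∘ there) λ x∈p y∈p e → suc-injective (f-inj (there x∈p) (there y∈p) e)
∣p∣≤∣q∣-injection {p = inside ∷ p} {q} f f∈q f-inj =
  ≤-trans (s≤s (∣p∣≤∣q∣-injection (f ∘ there) f∘there∈q-fhere
                  λ x∈p y∈p e → suc-injective (f-inj (there x∈p) (there y∈p) e)))
          (x∈p⇒∣p-x∣<∣p∣ (f∈q here))
  where
  f∘there∈q-fhere : ∀ {x} (x∈p : x ∈ p) → f (there x∈p) ∈ q - f here
  f∘there∈q-fhere x∈p = x∈p∧x≢y⇒x∈p-y (f∈q (there x∈p)) λ e → 0≢1+n (sym (f-inj (there x∈p) here e))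

n≤1+∣⊤-x∣ : ∀ {n} (x : Fin n) → n ≤ suc ∣ ⊤ - x ∣
n≤1+∣⊤-x∣ {n} x = subst (_≤ suc ∣ ⊤ - x ∣) (∣⊤∣≡n n) (∣p∣≤1+∣p-x∣ ⊤ x)

n≤2+∣⊤-x-y∣ : ∀ {n} (x y : Fin n) → n ≤ 2 + ∣ ⊤ - x - y ∣
n≤2+∣⊤-x-y∣ x y = ≤-trans (n≤1+∣⊤-x∣ x) (s≤s (∣p∣≤1+∣p-x∣ (⊤ - x) y))

∈∖⁺ : ∀ {n} {A X : Subset n} {x} → x ∈ A → x ∉ X → x ∈ A ∖ X
∈∖⁺ x∈A x∉X = x∈p∩q⁺ (x∈A , x∉p⇒x∈∁p x∉X)

∈∖⁻ : ∀ {n} {A X : Subset n} {x} → x ∈ A ∖ X → x ∈ A × x ∉ X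
∈∖⁻ {A = A} {X} x∈A∖X = let x∈A , x∈∁X = x∈p∩q⁻ A (∁ X) x∈A∖X in x∈A , x∈∁p⇒x∉p x∈∁X

preimage : ∀ {m n} → (Fin m → Fin n) → Subset n → Subset m
preimage f X = tabulate λ y → lookup X (f y)

∈-preimage⁺ : ∀ {m n} {f : Fin m → Fin n} {X y} → f y ∈ X → y ∈ preimage f X
∈-preimage⁺ fy∈X = ∈-tabulate⁺ ([]=⇒lookup fy∈X)

∈-preimage⁻ : ∀ {m n} {f : Fin m → Fin n} {X y} → y ∈ preimage f X → f y ∈ X
∈-preimage⁻ {f = f} {X} {y} y∈ = lookup⇒[]= (f y) X (∈-tabulate⁻ y∈)

∣preimage∣≤∣X∣ : ∀ {m n} {f : Fin m → Fin n} → Injective _≡_ _≡_ f → (X : Subset n) → ∣ preimage f X ∣ ≤ ∣ X ∣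
∣preimage∣≤∣X∣ {f = f} f-inj X =
  ∣p∣≤∣q∣-injection {p = preimage f X} {q = X} (λ {y} _ → f y) (∈-preimage⁻ {f = f}) (λ _ _ → f-inj)

0<sum⇒0<term : ∀ {n} (f : Fin n → ℕ) → 0 < sum (tabulate f) → ∃ λ x → 0 < f x
0<sum⇒0<term {suc n} f 0<Σ with f zero in f0≡
... | suc _ = zero , subst (0 <_) (sym f0≡) (s≤s z≤n)
... | zero  = let x , 0<fx = 0<sum⇒0<term (f ∘ suc) 0<Σ in suc x , 0<fx

∀⊎⇒⊎∀ : ∀ {n} {B : Set} (Q : Fin n → Set) → (∀ x → B ⊎ Q x) → B ⊎ (∀ x → Q x)
∀⊎⇒⊎∀ {zero} Q h = inj₂ λ ()
∀⊎⇒⊎∀ {suc n} Q h with h zero | ∀⊎⇒⊎∀ (Q ∘ suc) (h ∘ suc)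
... | inj₁ b  | _        = inj₁ b
... | inj₂ _  | inj₁ b   = inj₁ b
... | inj₂ q₀ | inj₂ qₛ  = inj₂ λ { zero → q₀ ; (suc x) → qₛ x }

module _ {n} {R : Fin n → Fin n → Bool} {A : Subset n} where

  Walk-join : ∀ {u x y v} → Walk R A u x → R x y ≡ true → Walk R A y v → Walk R A u v
  Walk-join (here u∈A)       xy yv = step u∈A xy yv
  Walk-join (step u∈A uw wx) xy yv = step u∈A uw (Walk-join wx xy yv)

  Walk-firstStep : ∀ {u v} → Walk R A u v → u ≢ v → ∃ λ w → R u w ≡ true × w ∈ A
  Walk-firstStep (here _)                   u≢u = contradiction refl u≢u
  Walk-firstStep (step _ uw (here w∈A))     _   = _ , uw , w∈A
  Walk-firstStep (step _ uw (step w∈A _ _)) _   = _ , uw , w∈A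

Walk-map : ∀ {m n} {R : Fin m → Fin m → Bool} {R' : Fin n → Fin n → Bool} {A A'} (f : Fin m → Fin n)
         → (∀ {a b} → R a b ≡ true → R' (f a) (f b) ≡ true) → (∀ {a} → a ∈ A → f a ∈ A')
         → ∀ {u v} → Walk R A u v → Walk R' A' (f u) (f v)
Walk-map f f-R f-A (here u∈A)       = here (f-A u∈A)
Walk-map f f-R f-A (step u∈A uw wv) = step (f-A u∈A) (f-R uw) (Walk-map f f-R f-A wv)

∈nbhd⁺ : ∀ {n} {G : SimpleGraph n} {u v} → adj G u v ≡ true → v ∈ nbhd G u
∈nbhd⁺ = ∈-tabulate⁺

∈nbhd⁻ : ∀ {n} {G : SimpleGraph n} {u v} → v ∈ nbhd G u → adj G u v ≡ true
∈nbhd⁻ = ∈-tabulate⁻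

lowDegree⇒¬KConnected : ∀ {n} (G : SimpleGraph n) {A : Subset n} {m u v} → u ∈ A → v ∈ A → u ≢ v
                      → adj G u v ≡ false → ∣ nbhd G u ∩ A ∣ < m → ¬ KConnected G A m
lowDegree⇒¬KConnected G {A} {u = u} {v} u∈A v∈A u≢v uv ∣N∣<m (_ , conn) =
  let w , uw , w∈A∖N = Walk-firstStep (conn N (p∩q⊆q _ A) ∣N∣<m u v (∈∖⁺ u∈A u∉N) (∈∖⁺ v∈A v∉N)) u≢v
      w∈A , w∉N      = ∈∖⁻ w∈A∖N
  in w∉N (x∈p∩q⁺ (∈nbhd⁺ {G = G} uw , w∈A))
  where
  N : Subset _
  N = nbhd G u ∩ A
  u∉N : u ∉ N
  u∉N u∈N = contradiction (trans (sym (irrefl G u)) (∈nbhd⁻ {G = G} (proj₁ (x∈p∩q⁻ _ A u∈N)))) λ ()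
  v∉N : v ∉ N
  v∉N v∈N = contradiction (trans (sym uv) (∈nbhd⁻ {G = G} (proj₁ (x∈p∩q⁻ _ A v∈N)))) λ ()

IsConnectivity-intro : ∀ {n} {G : SimpleGraph n} {A k} → KConnected G A k
                     → (∀ {m} → k < m → ¬ KConnected G A m) → IsConnectivity G A k
IsConnectivity-intro conn ¬conn = conn , λ m connₘ → ≮⇒≥ λ k<m → ¬conn k<m connₘ

data Cell {m n} : Fin (m * n) → Set where
  cell : (j : Fin m) (a : Fin n) → Cell (combine j a)

cellOf : ∀ {m} n (v : Fin (m * n)) → Cell v
cellOf {m} n v = subst (Cell {m} {n}) (combine-remQuot {m} n v) (cell (quotient n v) (remainder {m} n v))

quotient-combine : ∀ {m n} (j : Fin m) (a : Fin n) → quotient n (combine j a) ≡ j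
quotient-combine j a = cong proj₁ (remQuot-combine j a)

∈outsideCluster⁺ : ∀ {t i j} {a : Fin t} → j ≢ i → combine j a ∈ outsideCluster t i
∈outsideCluster⁺ {t} {i} {j} {a} j≢i = ∈-tabulate⁺ (begin
  not (does (quotient t (combine j a) ≟ i)) ≡⟨ cong (λ c → not (does (c ≟ i))) (quotient-combine j a) ⟩
  not (does (j ≟ i))                        ≡⟨ cong not (dec-false (j ≟ i) j≢i) ⟩
  true                                      ∎)
  where open ≡-Reasoning

∈outsideCluster⁻ : ∀ {t i j} {a : Fin t} → combine j a ∈ outsideCluster t i → j ≢ i
∈outsideCluster⁻ {t} {i} {j} {a} ja∈ refl = contradiction (begin
  true                                      ≡⟨ ∈-tabulate⁻ ja∈ ⟨
  not (does (quotient t (combine j a) ≟ i)) ≡⟨ cong (λ c → not (does (c ≟ i))) (quotient-combine j a) ⟩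
  not (does (i ≟ i))                        ≡⟨ cong not (dec-true (i ≟ i) refl) ⟩
  false                                     ∎) λ ()
  where open ≡-Reasoning

module Construction {d t} {G : SimpleGraph t} {H : SimpleGraph (t * t)} (C : IsConstruction d G H) where

  adj-sym : ∀ {u v} → adj H u v ≡ true → adj H v u ≡ true
  adj-sym {u} {v} uv = trans (SimpleGraph.sym H v u) uv

  adj-inCluster : ∀ j {a b} → adj G a b ≡ true → adj H (combine j a) (combine j b) ≡ true
  adj-inCluster j {a} {b} ab = trans (proj₁ C j a b) ab

  regular : Regular H (suc d)
  regular = proj₁ (proj₂ C)

  outNeighbour : ∀ j a → ∃ λ l → ∃ λ b → j ≢ l × adj H (combine j a) (combine l b) ≡ true
  outNeighbour j a = let l , b , j≢l , ja~lb , _ = proj₁ (proj₂ (proj₂ C)) j a in l , b , j≢l , ja~lb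

  outCluster : Fin t → Fin t → Fin t
  outCluster j a = proj₁ (outNeighbour j a)

  outCluster-unique : ∀ {j l a b} → j ≢ l → adj H (combine j a) (combine l b) ≡ true → l ≡ outCluster j a
  outCluster-unique {j} {l} {a} {b} j≢l ja~lb =
    let _ , _ , _ , _ , unique = proj₁ (proj₂ (proj₂ C)) j a in proj₁ (unique l b j≢l ja~lb)

  crossEdge : ∀ {j l} → j ≢ l → ∃ λ a → ∃ λ b → adj H (combine j a) (combine l b) ≡ true
  crossEdge {j} {l} j≢l =
    let a , 0<row = 0<sum⇒0<term _ (0<crossEdges (proj₂ (proj₂ (proj₂ C)) j l j≢l))
        b , b∈row = 0<∣p∣⇒Nonempty _ 0<row
    in a , b , ∈-tabulate⁻ b∈row
    where
    0<crossEdges : crossEdges H j l ≡ 1 ⊎ crossEdges H j l ≡ 2 → 0 < crossEdges H j l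
    0<crossEdges (inj₁ ≡1) = subst (0 <_) (sym ≡1) (s≤s z≤n)
    0<crossEdges (inj₂ ≡2) = subst (0 <_) (sym ≡2) (s≤s z≤n)

  module Outside (d+3≤t : d + 3 ≤ t) (i : Fin t) where

    A : Subset (t * t)
    A = outsideCluster t i

    d<∣⊤-x∣ : ∀ x → d < ∣ ⊤ - x ∣
    d<∣⊤-x∣ x = m+n≤o⇒n≤o 1 (+-cancelˡ-≤ 1 (2 + d) _ (begin
      3 + d          ≡⟨ +-comm 3 d ⟩
      d + 3          ≤⟨ d+3≤t ⟩
      t              ≤⟨ n≤1+∣⊤-x∣ x ⟩
      1 + ∣ ⊤ - x ∣  ∎))
      where open ≤-Reasoning

    0<∣⊤-x-y∣ : ∀ x y → 0 < ∣ ⊤ - x - y ∣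
    0<∣⊤-x-y∣ x y = +-cancelˡ-≤ 2 1 _ (≤-trans (m+n≤o⇒n≤o d d+3≤t) (n≤2+∣⊤-x-y∣ x y))

    d≤∣⊤-x-y-z∣ : ∀ x y z → d ≤ ∣ ⊤ - x - y - z ∣
    d≤∣⊤-x-y-z∣ x y z = +-cancelˡ-≤ 3 d _ (begin
      3 + d                  ≡⟨ +-comm 3 d ⟩
      d + 3                  ≤⟨ d+3≤t ⟩
      t                      ≤⟨ n≤2+∣⊤-x-y∣ x y ⟩
      2 + ∣ ⊤ - x - y ∣      ≤⟨ s≤s (s≤s (∣p∣≤1+∣p-x∣ (⊤ - x - y) z)) ⟩
      3 + ∣ ⊤ - x - y - z ∣  ∎)
      where open ≤-Reasoning

    module _ (G-conn : KConnected G ⊤ d) (X : Subset (t * t)) (∣X∣<d : ∣ X ∣ < d) where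

      inClusterWalk : ∀ {j} → j ≢ i → ∀ {a b} → combine j a ∉ X → combine j b ∉ X
                    → Walk (adj H) (A ∖ X) (combine j a) (combine j b)
      inClusterWalk {j} j≢i {a} {b} ja∉X jb∉X =
        Walk-map (combine j) (adj-inCluster j) keep
          (proj₂ G-conn Xⱼ ⊆⊤ ∣Xⱼ∣<d a b (avoid ja∉X) (avoid jb∉X))
        where
        Xⱼ : Subset t
        Xⱼ = preimage (combine j) X
        ∣Xⱼ∣<d : ∣ Xⱼ ∣ < d
        ∣Xⱼ∣<d = ≤-<-trans (∣preimage∣≤∣X∣ (combine-injectiveʳ j _ j _) X) ∣X∣<d
        avoid : ∀ {y} → combine j y ∉ X → y ∈ ⊤ ∖ Xⱼ
        avoid jy∉X = ∈∖⁺ ∈⊤ (jy∉X ∘ ∈-preimage⁻ {f = combine j})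
        keep : ∀ {y} → y ∈ ⊤ ∖ Xⱼ → combine j y ∈ A ∖ X
        keep y∈⊤∖Xⱼ = ∈∖⁺ (∈outsideCluster⁺ {t} j≢i) (proj₂ (∈∖⁻ y∈⊤∖Xⱼ) ∘ ∈-preimage⁺)

      module _ {j k} (j≢i : j ≢ i) (k≢i : k ≢ i) {a b}
               (ja∉X : combine j a ∉ X) (kb∉X : combine k b ∉ X) where

        Path : Set
        Path = Walk (adj H) (A ∖ X) (combine j a) (combine k b)

        Blocks : Fin t → Fin t → Fin t → Set
        Blocks l c x = c ≡ l ⊎ ((c ≡ j ⊎ c ≡ k) × outCluster c x ≡ l)

        record Blocker (l : Fin t) : Set where
          constructor blocker
          field
            cluster position : Fin t
            ∈X     : combine cluster position ∈ X
            blocks : Blocks l cluster position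
          vertex : Fin (t * t)
          vertex = combine cluster position

        Blocks-functional : ∀ {l l' c x} → l ≢ j → l ≢ k → l' ≢ j → l' ≢ k
                          → Blocks l c x → Blocks l' c x → l ≡ l'
        Blocks-functional _   _   _    _    (inj₁ refl)            (inj₁ c≡l')            = c≡l'
        Blocks-functional l≢j _   _    _    (inj₁ refl)            (inj₂ (inj₁ refl , _)) = contradiction refl l≢j
        Blocks-functional _   l≢k _    _    (inj₁ refl)            (inj₂ (inj₂ refl , _)) = contradiction refl l≢k
        Blocks-functional _   _   l'≢j _    (inj₂ (inj₁ refl , _)) (inj₁ refl)            = contradiction refl l'≢j
        Blocks-functional _   _   _    l'≢k (inj₂ (inj₂ refl , _)) (inj₁ refl)            = contradiction refl l'≢k
        Blocks-functional _   _   _    _    (inj₂ (_ , refl))      (inj₂ (_ , out≡l'))    = out≡l'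

        Blocker-injective : ∀ {l l'} → l ≢ j → l ≢ k → l' ≢ j → l' ≢ k → (β : Blocker l) (β' : Blocker l')
                          → Blocker.vertex β ≡ Blocker.vertex β' → l ≡ l'
        Blocker-injective l≢j l≢k l'≢j l'≢k (blocker c x _ bl) (blocker c' x' _ bl') e
          with refl ← combine-injectiveˡ c x c' x' e | refl ← combine-injectiveʳ c x c' x' e =
          Blocks-functional l≢j l≢k l'≢j l'≢k bl bl'

        detour : ∀ {l} → l ≢ i → l ≢ j → l ≢ k → Path ⊎ Blocker l
        detour {l} l≢i l≢j l≢k with crossEdge (l≢j ∘ sym) | crossEdge l≢k
        ... | a₁ , b₁ , ja₁~lb₁ | c₁ , b₂ , lc₁~kb₂
          with combine j a₁ ∈? X | combine l b₁ ∈? X | combine l c₁ ∈? X | combine k b₂ ∈? X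
        ... | yes ∈X | _ | _ | _ =
          inj₂ (blocker j a₁ ∈X (inj₂ (inj₁ refl , sym (outCluster-unique (l≢j ∘ sym) ja₁~lb₁))))
        ... | no _ | yes ∈X | _ | _ = inj₂ (blocker l b₁ ∈X (inj₁ refl))
        ... | no _ | no _ | yes ∈X | _ = inj₂ (blocker l c₁ ∈X (inj₁ refl))
        ... | no _ | no _ | no _ | yes ∈X =
          inj₂ (blocker k b₂ ∈X (inj₂ (inj₂ refl , sym (outCluster-unique (l≢k ∘ sym) (adj-sym lc₁~kb₂)))))
        ... | no ∉₁ | no ∉₂ | no ∉₃ | no ∉₄ =
          inj₁ (Walk-join (inClusterWalk j≢i ja∉X ∉₁) ja₁~lb₁
               (Walk-join (inClusterWalk l≢i ∉₂ ∉₃) lc₁~kb₂ (inClusterWalk k≢i ∉₄ kb∉X)))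

        others : Subset t
        others = ⊤ - i - j - k

        ∈others⁻ : ∀ {l} → l ∈ others → l ≢ i × l ≢ j × l ≢ k
        ∈others⁻ l∈others =
          let l∈⊤-i-j , l≢k = x∈p-y⁻ l∈others
              l∈⊤-i , l≢j   = x∈p-y⁻ l∈⊤-i-j
          in proj₂ (x∈p-y⁻ l∈⊤-i) , l≢j , l≢k

        detour-others : ∀ l → Path ⊎ (l ∈ others → Blocker l)
        detour-others l with l ∈? others
        ... | no l∉others = inj₂ λ l∈others → contradiction l∈others l∉others
        ... | yes l∈others =
          let l≢i , l≢j , l≢k = ∈others⁻ l∈others in map₂ const (detour l≢i l≢j l≢k)

        path : Path
        path with ∀⊎⇒⊎∀ (λ l → l ∈ others → Blocker l) detour-others
        ... | inj₁ p = p
        ... | inj₂ blocked = contradiction (<-≤-trans ∣X∣<d (d≤∣⊤-x-y-z∣ i j k)) (≤⇒≯ ∣others∣≤∣X∣)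
          where
          open Blocker
          ∣others∣≤∣X∣ : ∣ others ∣ ≤ ∣ X ∣
          ∣others∣≤∣X∣ = ∣p∣≤∣q∣-injection (λ l∈ → vertex (blocked _ l∈)) (λ l∈ → ∈X (blocked _ l∈))
            λ {l} {l'} l∈ l'∈ →
              let _ , l≢j , l≢k = ∈others⁻ l∈ ; _ , l'≢j , l'≢k = ∈others⁻ l'∈ in
              Blocker-injective l≢j l≢k l'≢j l'≢k (blocked l l∈) (blocked l' l'∈)

      connected : Connected H (A ∖ X)
      connected u v u∈A∖X v∈A∖X with cellOf {t} t u | cellOf {t} t v
      ... | cell j a | cell k b =
        let ja∈A , ja∉X = ∈∖⁻ u∈A∖X ; kb∈A , kb∉X = ∈∖⁻ v∈A∖X in
        path (∈outsideCluster⁻ {t} ja∈A) (∈outsideCluster⁻ {t} kb∈A) ja∉X kb∉X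

    outside-KConnected : KConnected G ⊤ d → KConnected H A d
    outside-KConnected G-conn =
      ≤-trans (d<∣⊤-x∣ i) ∣⊤-i∣≤∣A∣ , λ X _ ∣X∣<d → connected G-conn X ∣X∣<d
      where
      ∣⊤-i∣≤∣A∣ : ∣ ⊤ - i ∣ ≤ ∣ A ∣
      ∣⊤-i∣≤∣A∣ = ∣p∣≤∣q∣-injection {p = ⊤ - i} {q = A} (λ {l} _ → combine l i)
                    (λ l∈ → ∈outsideCluster⁺ {t} (proj₂ (x∈p-y⁻ l∈))) λ _ _ → combine-injectiveˡ _ _ _ _

    module _ {x j y} (i≢j : i ≢ j) (ix~jy : adj H (combine i x) (combine j y) ≡ true) where

      ∣nbhd∩A∣≤d : ∣ nbhd H (combine j y) ∩ A ∣ ≤ d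
      ∣nbhd∩A∣≤d = s≤s⁻¹ (begin
        suc ∣ nbhd H (combine j y) ∩ A ∣            ≤⟨ s≤s (p⊆q⇒∣p∣≤∣q∣ nbhd∩A⊆nbhd-ix) ⟩
        suc ∣ nbhd H (combine j y) - combine i x ∣  ≤⟨ x∈p⇒∣p-x∣<∣p∣ (∈nbhd⁺ {G = H} (adj-sym ix~jy)) ⟩
        ∣ nbhd H (combine j y) ∣                    ≡⟨ regular (combine j y) ⟩
        suc d                                       ∎)
        where
        open ≤-Reasoning
        nbhd∩A⊆nbhd-ix : nbhd H (combine j y) ∩ A ⊆ nbhd H (combine j y) - combine i x
        nbhd∩A⊆nbhd-ix w∈ = let w∈nbhd , w∈A = x∈p∩q⁻ _ A w∈ in
          x∈p∧x≢y⇒x∈p-y w∈nbhd λ { refl → ∈outsideCluster⁻ {t} w∈A refl }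

      jy≁kb : ∀ {k b} → k ≢ i → k ≢ j → adj H (combine j y) (combine k b) ≡ false
      jy≁kb k≢i k≢j = ¬-not λ jy~kb →
        k≢i (trans (outCluster-unique (k≢j ∘ sym) jy~kb)
                   (sym (outCluster-unique (i≢j ∘ sym) (adj-sym ix~jy))))

      ¬KConnected-above : ∀ {m} → d < m → ¬ KConnected H A m
      ¬KConnected-above d<m =
        let k , k∈⊤-i-j = 0<∣p∣⇒Nonempty (⊤ - i - j) (0<∣⊤-x-y∣ i j)
            k∈⊤-i , k≢j = x∈p-y⁻ k∈⊤-i-j
            k≢i         = proj₂ (x∈p-y⁻ k∈⊤-i)
        in lowDegree⇒¬KConnected H (∈outsideCluster⁺ {t} (i≢j ∘ sym)) (∈outsideCluster⁺ {t} {a = x} k≢i)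
             (λ e → k≢j (sym (combine-injectiveˡ _ _ _ _ e))) (jy≁kb k≢i k≢j) (≤-<-trans ∣nbhd∩A∣≤d d<m)

    outside-¬KConnected : ∀ {m} → d < m → ¬ KConnected H A m
    outside-¬KConnected = let j , y , i≢j , ii~jy = outNeighbour i i in ¬KConnected-above i≢j ii~jy

lemma5 : (d t : ℕ) → d + 3 ≤ t → (G : SimpleGraph t) → Regular G d → KConnected G ⊤ d
         → (k : ℕ) → suc k ≡ d → IsKappa3 G k
         → (H : SimpleGraph (t * t)) → IsConstruction d G H
         → (i : Fin t) → IsConnectivity H (outsideCluster t i) d
lemma5 d t d+3≤t G _ G-conn _ _ _ H C i =
  IsConnectivity-intro {G = H} {A = outsideCluster t i} (outside-KConnected G-conn) outside-¬KConnected
  where open Construction.Outside {d} {t} {G} {H} C d+3≤t i
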